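{- Let a bipartite graph $G$ be factored into graphs $H$ and $K$. Then at most one of $H$ and $K$ is connected.
   Context: All graphs are finite and simple. A graph $G$ is factored into graphs $H$ and $K$ (all on $n$ vertices) if there exist adjacency matrices $A,B,C$ of $G,H,K$ respectively (symmetric $n\times n$ $(0,1)$-matrices with zero diagonal, for some vertex orderings) with $A=BC$; the three graphs are then regarded as having the common vertex set $\{1,\dots,n\}$. -}

module Defs where

open import Data.Nat using (ℕ; zero; suc; _+_; _*_)
open import Data.Fin using (Fin; zero; suc)
open import Data.Bool using (Bool)
open import Data.Sum using (_⊎_)
open import Data.Product using (∃)
open import Relation.Binary.PropositionalEquality using (_≡_; _≢_)

Matrix : ℕ → Set
Matrix n = Fin n → Fin n → ℕ

∑ : ∀ {n} → (Fin n → ℕ) → ℕ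
∑ {zero}  f = 0
∑ {suc n} f = f zero + ∑ (λ k → f (suc k))

-- ordinary matrix product (over ℕ, hence over ℤ)
_⊗_ : ∀ {n} → Matrix n → Matrix n → Matrix n
(B ⊗ C) i j = ∑ (λ k → B i k * C k j)

record IsAdjacencyMatrix {n : ℕ} (M : Matrix n) : Set where
  field
    zero-or-one : ∀ i j → M i j ≡ 0 ⊎ M i j ≡ 1
    symmetric   : ∀ i j → M i j ≡ M j i
    zero-diag   : ∀ i → M i i ≡ 0

data Reachable {n : ℕ} (M : Matrix n) : Fin n → Fin n → Set where
  here : ∀ {i} → Reachable M i i
  step : ∀ {i j k} → M i j ≡ 1 → Reachable M j k → Reachable M i k

Connected : ∀ {n} → Matrix n → Set
Connected {n} M = ∀ (i j : Fin n) → Reachable M i j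

Bipartite : ∀ {n} → Matrix n → Set
Bipartite {n} M = ∃ λ (colour : Fin n → Bool) → ∀ i j → M i j ≡ 1 → colour i ≢ colour j

{-# OPTIONS --safe #-}
module Submission where

open import Defs
open import Data.Nat using (ℕ; _≤_; _*_; suc; z≤n; s≤s)
open import Data.Nat.Properties using (≤-trans; m≤m+n; m≤n+m)
open import Data.Fin using (Fin; zero; suc; punchIn)
open import Data.Fin.Properties using (punchInᵢ≢i)
open import Data.Bool using (Bool; true; false; not; _xor_)
open import Data.Bool.Properties using (not-¬; ¬-not; not-distribˡ-xor; xor-assoc; xor-comm; xor-same; xor-identityʳ)
open import Data.Sum using (inj₁; inj₂)
open import Data.Product using (_×_; _,_; ∃; proj₁; proj₂)
open import Relation.Nullary using (¬_; contradiction)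
open import Relation.Binary.PropositionalEquality

-- Every H-edge i k followed by a K-edge k j gives a G-edge i j, so c i ≠ c j for a proper
-- 2-colouring c of G. Hence, around each vertex v, all H-neighbours share one colour a v and
-- all K-neighbours have the other one. The offset a v xor c v is invariant along H-edges, so
-- it is a constant δ when H is connected; then every H-edge changes the colour by δ and every
-- K-edge by not δ. One of H, K therefore preserves colours; if it were connected, c would be
-- constant, although the other graph has an edge that changes the colour.

xor-cancelʳ : ∀ x y → (x xor y) xor y ≡ x
xor-cancelʳ x y = begin
  (x xor y) xor y  ≡⟨ xor-assoc x y y ⟩
  x xor (y xor y)  ≡⟨ cong (x xor_) (xor-same y) ⟩
  x xor false      ≡⟨ xor-identityʳ x ⟩
  x                ∎
  where open ≡-Reasoning

term≤∑ : ∀ {n} (f : Fin n → ℕ) (k : Fin n) → f k ≤ ∑ f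
term≤∑ f zero    = m≤m+n _ _
term≤∑ f (suc k) = ≤-trans (term≤∑ (λ k → f (suc k)) k) (m≤n+m _ _)

module _ {n : ℕ} where

  path⇒1≤⊗ : {B C : Matrix n} → ∀ {i k j} → B i k ≡ 1 → C k j ≡ 1 → 1 ≤ (B ⊗ C) i j
  path⇒1≤⊗ {B} {C} {i} {k} {j} Bik≡1 Ckj≡1 =
    subst (_≤ (B ⊗ C) i j) (cong₂ _*_ Bik≡1 Ckj≡1) (term≤∑ (λ k → B i k * C k j) k)

  ⊗-edge : {A B C : Matrix n} → IsAdjacencyMatrix A → (∀ i j → A i j ≡ (B ⊗ C) i j) →
           ∀ {i k j} → B i k ≡ 1 → C k j ≡ 1 → A i j ≡ 1
  ⊗-edge {B = B} {C} adjA A≡B⊗C {i} {k} {j} Bik≡1 Ckj≡1 with IsAdjacencyMatrix.zero-or-one adjA i j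
  ... | inj₂ Aij≡1 = Aij≡1
  ... | inj₁ Aij≡0 =
    contradiction (subst (1 ≤_) (trans (sym (A≡B⊗C i j)) Aij≡0) (path⇒1≤⊗ {B = B} {C} Bik≡1 Ckj≡1)) λ ()

  reachable-preserves : {M : Matrix n} {A : Set} (f : Fin n → A) →
                        (∀ {i j} → M i j ≡ 1 → f i ≡ f j) →
                        ∀ {i j} → Reachable M i j → f i ≡ f j
  reachable-preserves f preserves here           = refl
  reachable-preserves f preserves (step e walk) = trans (preserves e) (reachable-preserves f preserves walk)

  reachable-≢⇒edge : {M : Matrix n} {v w : Fin n} → Reachable M v w → v ≢ w → ∃ λ u → M v u ≡ 1
  reachable-≢⇒edge here               v≢v = contradiction refl v≢v
  reachable-≢⇒edge (step {j = u} e _) _  = u , e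

  Shifts : Matrix n → (Fin n → Bool) → Bool → Set
  Shifts M c b = ∀ {i j} → M i j ≡ 1 → c j ≡ b xor c i

  connected-preserving⇒¬flipping : {M M′ : Matrix n} {c : Fin n → Bool} →
    Connected M → Shifts M c false → Shifts M′ c true → ∀ {i j} → ¬ (M′ i j ≡ 1)
  connected-preserving⇒¬flipping {c = c} conM preserves flips {i} {j} e =
    not-¬ (reachable-preserves c (λ e′ → sym (preserves e′)) (conM j i)) (flips e)

connected⇒neighbour : ∀ {m} {M : Matrix (suc (suc m))} → Connected M →
                      ∀ v → ∃ λ w → M v w ≡ 1
connected⇒neighbour conM v =
  reachable-≢⇒edge (conM v (punchIn v zero)) (λ v≡w → punchInᵢ≢i v zero (sym v≡w))

module _ {n : ℕ} {B C : Matrix n} (c : Fin n → Bool)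
         (bichromatic : ∀ {i k j} → B i k ≡ 1 → C k j ≡ 1 → c i ≢ c j)
         (B-symmetric : ∀ i j → B i j ≡ B j i)
         (B-neighbour : ∀ v → ∃ λ w → B v w ≡ 1)
         (C-neighbour : ∀ v → ∃ λ w → C v w ≡ 1) where

  B-colour : Fin n → Bool
  B-colour v = c (proj₁ (B-neighbour v))

  private
    B-reverse : ∀ {i j} → B i j ≡ 1 → B j i ≡ 1
    B-reverse {i} {j} e = trans (B-symmetric j i) e

    differs-from-C-neighbour : ∀ {v i} → B v i ≡ 1 → c i ≢ c (proj₁ (C-neighbour v))
    differs-from-C-neighbour {v} e = bichromatic (B-reverse e) (proj₂ (C-neighbour v))

  B-neighbour-colour : ∀ {v i} → B v i ≡ 1 → c i ≡ B-colour v
  B-neighbour-colour e = trans (¬-not (differs-from-C-neighbour e))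
    (sym (¬-not (differs-from-C-neighbour (proj₂ (B-neighbour _)))))

  C-neighbour-colour : ∀ {v j} → C v j ≡ 1 → c j ≡ not (B-colour v)
  C-neighbour-colour {v} e = ¬-not (≢-sym (bichromatic (B-reverse (proj₂ (B-neighbour v))) e))

  offset : Fin n → Bool
  offset v = B-colour v xor c v

  offset-invariant : ∀ {i k} → B i k ≡ 1 → offset i ≡ offset k
  offset-invariant {i} {k} e = begin
    B-colour i xor c i  ≡⟨ cong₂ _xor_ (sym (B-neighbour-colour e)) (B-neighbour-colour (B-reverse e)) ⟩
    c k xor B-colour k  ≡⟨ xor-comm (c k) (B-colour k) ⟩
    B-colour k xor c k  ∎
    where open ≡-Reasoning

  B-shift : ∀ {i k} → B i k ≡ 1 → c k ≡ offset i xor c i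
  B-shift {i} e = trans (B-neighbour-colour e) (sym (xor-cancelʳ (B-colour i) (c i)))

  C-shift : ∀ {k j} → C k j ≡ 1 → c j ≡ not (offset k) xor c k
  C-shift {k} e = begin
    c _                                ≡⟨ C-neighbour-colour e ⟩
    not (B-colour k)                   ≡⟨ cong not (sym (xor-cancelʳ (B-colour k) (c k))) ⟩
    not ((B-colour k xor c k) xor c k) ≡⟨ not-distribˡ-xor (offset k) (c k) ⟩
    not (offset k) xor c k             ∎
    where open ≡-Reasoning

  complementary-shifts : Connected B → Fin n → ∃ λ δ → Shifts B c δ × Shifts C c (not δ)
  complementary-shifts conB o = offset o , B-shifts , C-shifts
    where
    offset≡ : ∀ v → offset v ≡ offset o
    offset≡ v = reachable-preserves offset offset-invariant (conB v o)

    B-shifts : Shifts B c (offset o)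
    B-shifts {i} e = trans (B-shift e) (cong (_xor c i) (offset≡ i))

    C-shifts : Shifts C c (not (offset o))
    C-shifts {k} e = trans (C-shift e) (cong (λ δ → not δ xor c k) (offset≡ k))

proposition5p3 : (n : ℕ) → 2 ≤ n → (A B C : Matrix n) →
    IsAdjacencyMatrix A → IsAdjacencyMatrix B → IsAdjacencyMatrix C →
    (∀ i j → A i j ≡ (B ⊗ C) i j) → Bipartite A →
    ¬ (Connected B × Connected C)
proposition5p3 (suc (suc m)) (s≤s (s≤s z≤n)) A B C adjA adjB _ A≡B⊗C (c , proper) (conB , conC)
  with complementary-shifts c bichromatic (IsAdjacencyMatrix.symmetric adjB)
         (connected⇒neighbour conB) (connected⇒neighbour conC) conB zero
  where
  bichromatic : ∀ {i k j} → B i k ≡ 1 → C k j ≡ 1 → c i ≢ c j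
  bichromatic Bik≡1 Ckj≡1 = proper _ _ (⊗-edge {B = B} {C} adjA A≡B⊗C Bik≡1 Ckj≡1)
... | false , B-preserves , C-flips =
  connected-preserving⇒¬flipping conB B-preserves C-flips (proj₂ (connected⇒neighbour conC zero))
... | true , B-flips , C-preserves =
  connected-preserving⇒¬flipping conC C-preserves B-flips (proj₂ (connected⇒neighbour conB zero))
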